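{- Assume Schinzel's Hypothesis H. Let $A=\{a\in\mathbb{Z}_{>0} : a^2+1 \text{ is prime}\}$, enumerated increasingly as $a_1<a_2<a_3<\cdots$. Then $j(a_n)>1$ for infinitely many $n$; equivalently, there are infinitely many $n\ge 2$ such that $a_n-a_{n-1}\notin A$.
   Context: For $n\ge 2$, $j(a_n)$ denotes the smallest integer $i$ with $1\le i\le n-1$ such that $a_n-a_{n-i}\in A$ (with $j(a_n)=\infty$ if no such $i$ exists). A finite set of polynomials $f_1,\dots,f_k\in\mathbb{Z}[x]$ satisfies the Bunyakovsky condition if there is no prime $p$ such that $\prod_i f_i(a)\equiv 0 \pmod p$ for all $a\in\mathbb{F}_p$. Schinzel's Hypothesis H: if $f_1,\dots,f_k\in\mathbb{Z}[x]$ are irreducible with positive leading coefficients and satisfy the Bunyakovsky condition, then there are infinitely many positive integers $x$ for which $f_1(x),\dots,f_k(x)$ are all prime. -}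

module Defs where

open import Data.Nat as ℕ using (ℕ; zero; suc)
open import Data.Nat.Primality using (Prime)
open import Data.Integer as ℤ using (ℤ; +_; _*_; _+_)
open import Data.Integer.Divisibility as ℤD using ()
open import Data.List using (List; []; _∷_; map; foldr)
open import Data.List.Relation.Unary.All using (All)
open import Data.Product using (Σ; ∃; _×_; _,_)
open import Data.Sum using (_⊎_)
open import Relation.Nullary using (¬_)
open import Relation.Binary.PropositionalEquality using (_≡_)

-- Polynomials in ℤ[x], as coefficient lists (constant term first).
-- Trailing zeros are allowed; polynomial equality is coefficientwise.

Poly : Set
Poly = List ℤ

coeff : Poly → ℕ → ℤ
coeff []       _       = + 0
coeff (c ∷ f)  zero    = c
coeff (c ∷ f)  (suc k) = coeff f k

_≈ₚ_ : Poly → Poly → Set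
f ≈ₚ g = ∀ k → coeff f k ≡ coeff g k

addP : Poly → Poly → Poly
addP []      g       = g
addP f@(_ ∷ _) []    = f
addP (a ∷ f) (b ∷ g) = (a + b) ∷ addP f g

mulP : Poly → Poly → Poly
mulP []      g = []
mulP (c ∷ f) g = addP (map (c *_) g) (+ 0 ∷ mulP f g)

eval : Poly → ℤ → ℤ
eval []      x = + 0
eval (c ∷ f) x = c + x * eval f x

IsUnitP : Poly → Set
IsUnitP g = ∃ λ u → mulP g u ≈ₚ (+ 1 ∷ [])

IsZeroP : Poly → Set
IsZeroP f = ∀ k → coeff f k ≡ + 0

IrreducibleP : Poly → Set
IrreducibleP f =
  ¬ IsZeroP f × ¬ IsUnitP f ×
  (∀ g h → f ≈ₚ mulP g h → IsUnitP g ⊎ IsUnitP h)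

PosLeadingP : Poly → Set
PosLeadingP f = ∃ λ d → ℤ.0ℤ ℤ.< coeff f d × (∀ k → d ℕ.< k → coeff f k ≡ + 0)

Bunyakovsky : List Poly → Set
Bunyakovsky fs =
  ¬ (∃ λ p → Prime p × (∀ a → a ℕ.< p →
       (+ p) ℤD.∣ foldr (λ f r → eval f (+ a) * r) (+ 1) fs))

HypothesisH : Set
HypothesisH =
  ∀ (fs : List Poly) → All IrreducibleP fs → All PosLeadingP fs → Bunyakovsky fs →
  ∀ (N : ℕ) → ∃ λ (x : ℕ) → N ℕ.< x ×
    All (λ f → ∃ λ q → Prime q × eval f (+ x) ≡ + q) fs

InA : ℕ → Set
InA a = 0 ℕ.< a × Prime (a ℕ.* a ℕ.+ 1)

-- a : ℕ → ℕ is the increasing enumeration of A (0-indexed: a 0 = a₁)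
EnumeratesA : (ℕ → ℕ) → Set
EnumeratesA a = (∀ n → a n ℕ.< a (suc n)) × (∀ m → InA m → ∃ λ n → a n ≡ m) × (∀ n → InA (a n))

-- The polynomials (130t + 66)² + 1 and (130t + 74)² + 1 are primitive quadratics of negative
-- discriminant, hence irreducible, and the products of their values at t = 0 and t = 1 are coprime,
-- so Hypothesis H yields arbitrarily large t with 130t + 66 and 130t + 74 both in A. For 67 ≤ s ≤ 73
-- the number s² + 1 has a factor 2, 5 or 13, which divides 130 and hence (130t + s)² + 1, so no
-- element of A lies strictly between them. They are therefore consecutive in A, and their
-- difference 8 is not in A since 8² + 1 = 5 · 13.
module Submission where

open import Defs
open import Data.Nat using (ℕ; suc; _≤_; _∸_)
open import Data.Product using (∃; _×_)
open import Relation.Nullary using (¬_)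

open import Data.Nat as ℕ using (zero; s≤s; z<s; _<_; _>_; NonZero; NonTrivial)
import Data.Nat.Properties as ℕ
open import Data.Nat.Coprimality using (Coprime; coprime?; coprime-divisor)
open import Data.Nat.Divisibility as ℕ using (divides)
open import Data.Nat.Primality using (Prime; Composite; prime?; prime⇒nonTrivial; composite; composite⇒¬prime)
import Data.Nat.Tactic.RingSolver as ℕ-Solver
open import Data.Integer as ℤ using (ℤ; +_; 0ℤ; ∣_∣; sign; +<+)
import Data.Integer.Properties as ℤ
import Data.Integer.Divisibility as ℤ
import Data.Integer.Tactic.RingSolver as ℤ-Solver
import Data.Sign.Properties as Sign
open import Data.List using (List; []; _∷_; map; foldr)
open import Data.List.Relation.Unary.All using (All; []; _∷_)
open import Data.Product using (_,_; proj₁; proj₂)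
open import Data.Sum using (_⊎_; inj₁; inj₂)
open import Data.Empty using (⊥-elim)
open import Data.Unit using (tt)
open import Function using (_∘_)
open import Relation.Nullary using (yes; no)
open import Relation.Nullary.Decidable using (from-yes; from-no)
open import Relation.Binary.Definitions using (tri<; tri≈; tri>)
open import Relation.Binary.PropositionalEquality

module _ where
  open import Data.Integer using (_+_; _*_; _-_)

  i*i≡+∣i∣*∣i∣ : ∀ i → i * i ≡ + (∣ i ∣ ℕ.* ∣ i ∣)
  i*i≡+∣i∣*∣i∣ i = trans (cong (ℤ._◃ (∣ i ∣ ℕ.* ∣ i ∣)) (Sign.s*s≡+ (sign i))) (ℤ.+◃n≡+n _)

  i∣i*j : ∀ i j → i ℤ.∣ i * j
  i∣i*j i j = subst (∣ i ∣ ℕ.∣_) (sym (ℤ.abs-* i j)) (ℕ.m∣m*n ∣ j ∣)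

  j∣i*j : ∀ i j → j ℤ.∣ i * j
  j∣i*j i j = subst (∣ j ∣ ℕ.∣_) (sym (ℤ.abs-* i j)) (ℕ.n∣m*n ∣ i ∣)

  discriminant-of-product : ∀ a b c d →
    (a * d - b * c) * (a * d - b * c) + + 4 * ((a * c) * (b * d)) ≡ (a * d + b * c) * (a * d + b * c)
  discriminant-of-product = ℤ-Solver.solve-∀

  convolve : (ℕ → ℤ) → (ℕ → ℤ) → ℕ → ℤ
  convolve G H zero    = G 0 * H 0
  convolve G H (suc k) = G 0 * H (suc k) + convolve (G ∘ suc) H k

  coeff-addP : ∀ f g k → coeff (addP f g) k ≡ coeff f k + coeff g k
  coeff-addP []      g       k       = sym (ℤ.+-identityˡ _)
  coeff-addP (a ∷ f) []      k       = sym (ℤ.+-identityʳ _)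
  coeff-addP (a ∷ f) (b ∷ g) zero    = refl
  coeff-addP (a ∷ f) (b ∷ g) (suc k) = coeff-addP f g k

  coeff-map-* : ∀ c g k → coeff (map (c *_) g) k ≡ c * coeff g k
  coeff-map-* c []      k       = sym (ℤ.*-zeroʳ c)
  coeff-map-* c (b ∷ g) zero    = refl
  coeff-map-* c (b ∷ g) (suc k) = coeff-map-* c g k

  convolve-zeroˡ : ∀ {G} H → (∀ i → G i ≡ 0ℤ) → ∀ k → convolve G H k ≡ 0ℤ
  convolve-zeroˡ H G≡0 zero    rewrite G≡0 0 = refl
  convolve-zeroˡ H G≡0 (suc k) rewrite G≡0 0 =
    trans (ℤ.+-identityˡ _) (convolve-zeroˡ H (G≡0 ∘ suc) k)

  convolve-zeroʳ : ∀ G {H} → (∀ i → H i ≡ 0ℤ) → ∀ k → convolve G H k ≡ 0ℤ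
  convolve-zeroʳ G H≡0 zero    rewrite H≡0 0 = ℤ.*-zeroʳ (G 0)
  convolve-zeroʳ G H≡0 (suc k) rewrite H≡0 (suc k) | ℤ.*-zeroʳ (G 0) =
    trans (ℤ.+-identityˡ _) (convolve-zeroʳ (G ∘ suc) H≡0 k)

  convolve-constˡ : ∀ {G} H → (∀ i → G (suc i) ≡ 0ℤ) → ∀ k → convolve G H k ≡ G 0 * H k
  convolve-constˡ H G₊≡0 zero    = refl
  convolve-constˡ H G₊≡0 (suc k) rewrite convolve-zeroˡ H G₊≡0 k = ℤ.+-identityʳ _

  convolve-constʳ : ∀ G {H} → (∀ i → H (suc i) ≡ 0ℤ) → ∀ k → convolve G H k ≡ G k * H 0
  convolve-constʳ G H₊≡0 zero    = refl
  convolve-constʳ G H₊≡0 (suc k) rewrite H₊≡0 k | ℤ.*-zeroʳ (G 0) =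
    trans (ℤ.+-identityˡ _) (convolve-constʳ (G ∘ suc) H₊≡0 k)

  coeff-mulP : ∀ f g k → coeff (mulP f g) k ≡ convolve (coeff f) (coeff g) k
  coeff-mulP []      g k       = sym (convolve-zeroˡ (coeff g) (λ _ → refl) k)
  coeff-mulP (c ∷ f) g zero    = begin
    coeff (addP (map (c *_) g) (+ 0 ∷ mulP f g)) 0 ≡⟨ coeff-addP (map (c *_) g) _ 0 ⟩
    coeff (map (c *_) g) 0 + 0ℤ                     ≡⟨ ℤ.+-identityʳ _ ⟩
    coeff (map (c *_) g) 0                          ≡⟨ coeff-map-* c g 0 ⟩
    c * coeff g 0                                   ∎
    where open ≡-Reasoning
  coeff-mulP (c ∷ f) g (suc k) = begin
    coeff (addP (map (c *_) g) (+ 0 ∷ mulP f g)) (suc k) ≡⟨ coeff-addP (map (c *_) g) _ (suc k) ⟩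
    coeff (map (c *_) g) (suc k) + coeff (mulP f g) k    ≡⟨ cong₂ _+_ (coeff-map-* c g (suc k)) (coeff-mulP f g k) ⟩
    c * coeff g (suc k) + convolve (coeff f) (coeff g) k ∎
    where open ≡-Reasoning

  VanishesAbove : (ℕ → ℤ) → ℕ → Set
  VanishesAbove G d = ∀ k → d < k → G k ≡ 0ℤ

  HasDegree : (ℕ → ℤ) → ℕ → Set
  HasDegree G d = G d ≢ 0ℤ × VanishesAbove G d

  convolve-vanishesAbove : ∀ {G H} m n → VanishesAbove G m → VanishesAbove H n →
                           VanishesAbove (convolve G H) (m ℕ.+ n)
  convolve-vanishesAbove {G} {H} zero n G>0≡0 H>n≡0 k n<k = begin
    convolve G H k ≡⟨ convolve-constˡ H (λ i → G>0≡0 (suc i) z<s) k ⟩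
    G 0 * H k      ≡⟨ cong (G 0 *_) (H>n≡0 k n<k) ⟩
    G 0 * 0ℤ       ≡⟨ ℤ.*-zeroʳ (G 0) ⟩
    0ℤ             ∎
    where open ≡-Reasoning
  convolve-vanishesAbove {G} {H} (suc m) n G>m≡0 H>n≡0 (suc k) (s≤s m+n<k)
    rewrite H>n≡0 (suc k) (s≤s (ℕ.≤-trans (ℕ.m≤n+m n m) (ℕ.<⇒≤ m+n<k)))
          | ℤ.*-zeroʳ (G 0) =
    trans (ℤ.+-identityˡ _) (convolve-vanishesAbove m n (λ i → G>m≡0 (suc i) ∘ s≤s) H>n≡0 k m+n<k)

  convolve-leading : ∀ {G H} m n → VanishesAbove G m → VanishesAbove H n →
                     convolve G H (m ℕ.+ n) ≡ G m * H n
  convolve-leading {G} {H} zero n G>0≡0 _ = convolve-constˡ H (λ i → G>0≡0 (suc i) z<s) n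
  convolve-leading {G} {H} (suc m) n G>m≡0 H>n≡0
    rewrite H>n≡0 (suc (m ℕ.+ n)) (s≤s (ℕ.m≤n+m n m)) | ℤ.*-zeroʳ (G 0) =
    trans (ℤ.+-identityˡ _) (convolve-leading m n (λ i → G>m≡0 (suc i) ∘ s≤s) H>n≡0)

  convolve-degree : ∀ {G H m n} → HasDegree G m → HasDegree H n →
                    HasDegree (convolve G H) (m ℕ.+ n)
  convolve-degree {G} {H} {m} {n} (Gm≢0 , G>m≡0) (Hn≢0 , H>n≡0) =
    leading≢0 ∘ trans (sym (convolve-leading m n G>m≡0 H>n≡0)) ,
    convolve-vanishesAbove m n G>m≡0 H>n≡0
    where
    leading≢0 : G m * H n ≢ 0ℤ
    leading≢0 GmHn≡0 with ℤ.i*j≡0⇒i≡0∨j≡0 (G m) GmHn≡0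
    ... | inj₁ Gm≡0 = Gm≢0 Gm≡0
    ... | inj₂ Hn≡0 = Hn≢0 Hn≡0

  degree-unique : ∀ {G m n} → HasDegree G m → HasDegree G n → m ≡ n
  degree-unique {G} {m} {n} (Gm≢0 , G>m≡0) (Gn≢0 , G>n≡0) with ℕ.<-cmp m n
  ... | tri< m<n _ _ = ⊥-elim (Gn≢0 (G>m≡0 n m<n))
  ... | tri≈ _ m≡n _ = m≡n
  ... | tri> _ _ n<m = ⊥-elim (Gm≢0 (G>n≡0 m n<m))

  degree-cong : ∀ {G H d} → (∀ k → G k ≡ H k) → HasDegree G d → HasDegree H d
  degree-cong {d = d} G≗H (Gd≢0 , G>d≡0) =
    Gd≢0 ∘ trans (G≗H d) , λ k d<k → trans (sym (G≗H k)) (G>d≡0 k d<k)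

  zero-or-degree : ∀ f → IsZeroP f ⊎ ∃ (HasDegree (coeff f))
  zero-or-degree [] = inj₁ (λ _ → refl)
  zero-or-degree (c ∷ f) with zero-or-degree f
  ... | inj₂ (d , fd≢0 , f>d≡0) = inj₂ (suc d , fd≢0 , λ { (suc k) (s≤s d<k) → f>d≡0 k d<k })
  ... | inj₁ f≡0 with c ℤ.≟ 0ℤ
  ...   | yes c≡0 = inj₁ λ { zero → c≡0 ; (suc k) → f≡0 k }
  ...   | no c≢0  = inj₂ (0 , c≢0 , λ { (suc k) _ → f≡0 k })

  constant-isUnit : ∀ g → (∀ i → coeff g (suc i) ≡ 0ℤ) → ∣ coeff g 0 ∣ ≡ 1 → IsUnitP g
  constant-isUnit g g₊≡0 ∣g₀∣≡1 = coeff g 0 ∷ [] , λ k →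
    trans (coeff-mulP g _ k) (trans (convolve-constʳ (coeff g) (λ _ → refl) k) (gₖg₀≡δ k))
    where
    gₖg₀≡δ : ∀ k → coeff g k * coeff g 0 ≡ coeff (+ 1 ∷ []) k
    gₖg₀≡δ zero    = trans (i*i≡+∣i∣*∣i∣ (coeff g 0)) (cong (λ n → + (n ℕ.* n)) ∣g₀∣≡1)
    gₖg₀≡δ (suc k) rewrite g₊≡0 k = refl

  one-degree : HasDegree (coeff (+ 1 ∷ [])) 0
  one-degree = (λ ()) , λ { (suc k) _ → refl }

  positive-degree⇒¬isUnit : ∀ f {d} → HasDegree (coeff f) (suc d) → ¬ IsUnitP f
  positive-degree⇒¬isUnit f fdeg (u , fu≈1) with zero-or-degree u
  ... | inj₁ u≡0 with trans (sym (fu≈1 0)) (trans (coeff-mulP f u 0) (convolve-zeroʳ (coeff f) u≡0 0))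
  ...   | ()
  positive-degree⇒¬isUnit f fdeg (u , fu≈1) | inj₂ (e , udeg) with
    degree-unique (degree-cong (sym ∘ coeff-mulP f u) (convolve-degree fdeg udeg))
                  (degree-cong (sym ∘ fu≈1) one-degree)
  ... | ()

  quadratic-vanishesAbove : ∀ c₀ c₁ c₂ → VanishesAbove (coeff (c₀ ∷ c₁ ∷ c₂ ∷ [])) 2
  quadratic-vanishesAbove c₀ c₁ c₂ (suc (suc (suc k))) _ = refl
  quadratic-vanishesAbove c₀ c₁ c₂ 1 (s≤s ())
  quadratic-vanishesAbove c₀ c₁ c₂ 2 (s≤s (s≤s ()))

  module _ {c₀ c₁ c₂ : ℤ} (c₂≢0 : c₂ ≢ 0ℤ) (coprime : Coprime ∣ c₀ ∣ ∣ c₂ ∣)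
           (discriminant-nonsquare : ∀ X → X * X + + 4 * (c₀ * c₂) ≢ c₁ * c₁) where

    private
      f : Poly
      f = c₀ ∷ c₁ ∷ c₂ ∷ []

      f-degree : HasDegree (coeff f) 2
      f-degree = c₂≢0 , quadratic-vanishesAbove c₀ c₁ c₂

      Factorisation : Poly → Poly → Set
      Factorisation g h = ∀ k → coeff f k ≡ convolve (coeff g) (coeff h) k

      constant-factor-isUnit : ∀ g → (∀ i → coeff g (suc i) ≡ 0ℤ) →
                               coeff g 0 ℤ.∣ c₀ → coeff g 0 ℤ.∣ c₂ → IsUnitP g
      constant-factor-isUnit g g₊≡0 g₀∣c₀ g₀∣c₂ = constant-isUnit g g₊≡0 (coprime (g₀∣c₀ , g₀∣c₂))

      factor-isUnit : ∀ g h m n → Factorisation g h → HasDegree (coeff g) m → HasDegree (coeff h) n →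
                      m ℕ.+ n ≡ 2 → IsUnitP g ⊎ IsUnitP h
      factor-isUnit g h 0 _ f≡gh (_ , g>0≡0) _ refl =
        inj₁ (constant-factor-isUnit g g₊≡0 (divides-coeff 0) (divides-coeff 2))
        where
        g₊≡0 : ∀ i → coeff g (suc i) ≡ 0ℤ
        g₊≡0 i = g>0≡0 (suc i) z<s
        divides-coeff : ∀ k → coeff g 0 ℤ.∣ coeff f k
        divides-coeff k = subst (coeff g 0 ℤ.∣_)
          (sym (trans (f≡gh k) (convolve-constˡ (coeff h) g₊≡0 k))) (i∣i*j (coeff g 0) (coeff h k))
      factor-isUnit g h 2 _ f≡gh _ (_ , h>0≡0) refl =
        inj₂ (constant-factor-isUnit h h₊≡0 (divides-coeff 0) (divides-coeff 2))
        where
        h₊≡0 : ∀ i → coeff h (suc i) ≡ 0ℤ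
        h₊≡0 i = h>0≡0 (suc i) z<s
        divides-coeff : ∀ k → coeff h 0 ℤ.∣ coeff f k
        divides-coeff k = subst (coeff h 0 ℤ.∣_)
          (sym (trans (f≡gh k) (convolve-constʳ (coeff g) h₊≡0 k))) (j∣i*j (coeff g k) (coeff h 0))
      factor-isUnit g h 1 _ f≡gh (_ , g>1≡0) (_ , h>1≡0) refl =
        ⊥-elim (discriminant-nonsquare (a * d - b * c) (begin
          (a * d - b * c) * (a * d - b * c) + + 4 * (c₀ * c₂)
            ≡⟨ cong₂ (λ u v → (a * d - b * c) * (a * d - b * c) + + 4 * (u * v)) (f≡gh 0) c₂≡bd ⟩
          (a * d - b * c) * (a * d - b * c) + + 4 * ((a * c) * (b * d))
            ≡⟨ discriminant-of-product a b c d ⟩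
          (a * d + b * c) * (a * d + b * c)
            ≡⟨ cong₂ _*_ (sym (f≡gh 1)) (sym (f≡gh 1)) ⟩
          c₁ * c₁ ∎))
        where
        open ≡-Reasoning
        a b c d : ℤ
        a = coeff g 0
        b = coeff g 1
        c = coeff h 0
        d = coeff h 1
        c₂≡bd : c₂ ≡ b * d
        c₂≡bd = trans (f≡gh 2) (convolve-leading 1 1 g>1≡0 h>1≡0)

      factorisation-isUnit : ∀ g h → Factorisation g h → IsUnitP g ⊎ IsUnitP h
      factorisation-isUnit g h f≡gh with zero-or-degree g | zero-or-degree h
      ... | inj₁ g≡0 | _ = ⊥-elim (c₂≢0 (trans (f≡gh 2) (convolve-zeroˡ (coeff h) g≡0 2)))
      ... | inj₂ _ | inj₁ h≡0 = ⊥-elim (c₂≢0 (trans (f≡gh 2) (convolve-zeroʳ (coeff g) h≡0 2)))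
      ... | inj₂ (m , gdeg) | inj₂ (n , hdeg) = factor-isUnit g h m n f≡gh gdeg hdeg
        (degree-unique (convolve-degree gdeg hdeg) (degree-cong f≡gh f-degree))

    quadratic-irreducible : IrreducibleP (c₀ ∷ c₁ ∷ c₂ ∷ [])
    quadratic-irreducible =
      (λ f≡0 → c₂≢0 (f≡0 2)) ,
      positive-degree⇒¬isUnit f f-degree ,
      λ g h f≈gh → factorisation-isUnit g h (λ k → trans (f≈gh k) (coeff-mulP g h k))

open import Data.Nat using (_+_; _*_)

evalℕ : List ℕ → ℕ → ℕ
evalℕ []       t = 0
evalℕ (c ∷ cs) t = c + t * evalℕ cs t

eval-map-+ : ∀ cs t → eval (map +_ cs) (+ t) ≡ + evalℕ cs t
eval-map-+ []       t = refl
eval-map-+ (c ∷ cs) t = begin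
  + c ℤ.+ + t ℤ.* eval (map +_ cs) (+ t) ≡⟨ cong (λ v → + c ℤ.+ + t ℤ.* v) (eval-map-+ cs t) ⟩
  + c ℤ.+ + t ℤ.* + evalℕ cs t           ≡⟨ cong (λ v → + c ℤ.+ v) (sym (ℤ.pos-* t _)) ⟩
  + c ℤ.+ + (t * evalℕ cs t)             ≡⟨ sym (ℤ.pos-+ c _) ⟩
  + evalℕ (c ∷ cs) t                     ∎
  where open ≡-Reasoning

squarePlusOne : ℕ → ℕ → Poly
squarePlusOne M r = map +_ (r * r + 1 ∷ 2 * M * r ∷ M * M ∷ [])

eval-squarePlusOne : ∀ M r t → eval (squarePlusOne M r) (+ t) ≡ + ((M * t + r) * (M * t + r) + 1)
eval-squarePlusOne M r t =
  trans (eval-map-+ (r * r + 1 ∷ 2 * M * r ∷ M * M ∷ []) t) (cong +_ (horner-square M r t))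
  where
  horner-square : ∀ M r t →
    r * r + 1 + t * (2 * M * r + t * (M * M + t * 0)) ≡ (M * t + r) * (M * t + r) + 1
  horner-square = ℕ-Solver.solve-∀

coprime-square : ∀ {m n} → Coprime m n → Coprime m (n * n)
coprime-square {m} {n} m⊥n (d∣m , d∣n*n) = m⊥n (d∣m , coprime-divisor d⊥n d∣n*n)
  where
  d⊥n : Coprime _ n
  d⊥n (e∣d , e∣n) = m⊥n (ℕ.∣-trans e∣d d∣m , e∣n)

square+m≢n : ∀ X {m n} → n < m → X ℤ.* X ℤ.+ + m ≢ + n
square+m≢n X {m} {n} n<m eq = ℕ.<⇒≱ n<m (begin
  m                     ≤⟨ ℕ.m≤n+m m (∣ X ∣ * ∣ X ∣) ⟩
  ∣ X ∣ * ∣ X ∣ + m     ≡⟨ ℤ.+-injective (trans (ℤ.pos-+ (∣ X ∣ * ∣ X ∣) m)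
                                                (trans (cong (ℤ._+ + m) (sym (i*i≡+∣i∣*∣i∣ X))) eq)) ⟩
  n                     ∎)
  where open ℕ.≤-Reasoning

squarePlusOne-discriminant : ∀ M r .{{_ : NonZero M}} X →
  X ℤ.* X ℤ.+ + 4 ℤ.* (+ (r * r + 1) ℤ.* + (M * M)) ≢ + (2 * M * r) ℤ.* + (2 * M * r)
squarePlusOne-discriminant M r X rewrite sym (ℤ.pos-* (r * r + 1) (M * M))
                                       | sym (ℤ.pos-* 4 ((r * r + 1) * (M * M)))
                                       | sym (ℤ.pos-* (2 * M * r) (2 * M * r)) =
  square+m≢n X (subst (2 * M * r * (2 * M * r) <_) (sym (four-c₀c₂ M r)) (ℕ.m<m+n _ 4M²>0))
  where
  four-c₀c₂ : ∀ M r → 4 * ((r * r + 1) * (M * M)) ≡ 2 * M * r * (2 * M * r) + 4 * (M * M)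
  four-c₀c₂ = ℕ-Solver.solve-∀
  4M²>0 : 4 * (M * M) > 0
  4M²>0 = ℕ.>-nonZero⁻¹ (4 * (M * M)) {{ℕ.m*n≢0 4 (M * M) {{_}} {{ℕ.m*n≢0 M M}}}}

squarePlusOne-irreducible : ∀ M r .{{_ : NonZero M}} → Coprime (r * r + 1) M →
                            IrreducibleP (squarePlusOne M r)
squarePlusOne-irreducible M r coprime =
  quadratic-irreducible (ℕ.≢-nonZero⁻¹ (M * M) {{ℕ.m*n≢0 M M}} ∘ ℤ.+-injective)
                        (coprime-square coprime)
                        (squarePlusOne-discriminant M r)

squarePlusOne-posLeading : ∀ M r .{{_ : NonZero M}} → PosLeadingP (squarePlusOne M r)
squarePlusOne-posLeading M r =
  2 , +<+ (ℕ.>-nonZero⁻¹ (M * M) {{ℕ.m*n≢0 M M}}) , quadratic-vanishesAbove _ _ _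

prime-value⇒InA : ∀ M r t {q} → 0 < r → Prime q → eval (squarePlusOne M r) (+ t) ≡ + q →
                  InA (M * t + r)
prime-value⇒InA M r t r>0 q-prime value≡q =
  ℕ.<-≤-trans r>0 (ℕ.m≤n+m r (M * t)) ,
  subst Prime (ℤ.+-injective (trans (sym value≡q) (eval-squarePlusOne M r t))) q-prime

evalProduct : List Poly → ℤ → ℤ
evalProduct fs x = foldr (λ f r → eval f x ℤ.* r) (+ 1) fs

coprime-values⇒bunyakovsky : ∀ fs → Coprime ∣ evalProduct fs (+ 0) ∣ ∣ evalProduct fs (+ 1) ∣ →
                             Bunyakovsky fs
coprime-values⇒bunyakovsky fs coprime (p , p-prime , p∣values) =
  ℕ.nonTrivial⇒≢1 (coprime (p∣values 0 (ℕ.<-trans z<s p>1) , p∣values 1 p>1))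
  where
  instance
    _ : NonTrivial p
    _ = prime⇒nonTrivial p-prime
  p>1 : p > 1
  p>1 = ℕ.nonTrivial⇒n>1 p

shifted-square-not-prime : ∀ {M} p s t → .{{NonTrivial p}} →
                           p ℕ.∣ M → p ℕ.∣ s * s + 1 → p < s * s + 1 →
                           ¬ Prime ((M * t + s) * (M * t + s) + 1)
shifted-square-not-prime {M} p s t p∣M p∣s²+1 p<s²+1 =
  composite⇒¬prime (subst Composite (sym (expand M t s)) (composite
    (ℕ.<-≤-trans p<s²+1 (ℕ.m≤n+m _ (M * (t * (M * t + 2 * s)))))
    (ℕ.∣m∣n⇒∣m+n (ℕ.∣-trans p∣M (ℕ.m∣m*n _)) p∣s²+1)))
  where
  expand : ∀ M t s → (M * t + s) * (M * t + s) + 1 ≡ M * (t * (M * t + 2 * s)) + (s * s + 1)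
  expand = ℕ-Solver.solve-∀

module _ {a : ℕ → ℕ} (enum : EnumeratesA a) where
  private
    a-step : ∀ n → a n < a (suc n)
    a-step = proj₁ enum

    a-onto : ∀ m → InA m → ∃ λ n → a n ≡ m
    a-onto = proj₁ (proj₂ enum)

    a∈A : ∀ n → InA (a n)
    a∈A = proj₂ (proj₂ enum)

  enumeration-strictMono : ∀ {i j} → i < j → a i < a j
  enumeration-strictMono {i} {suc j} i<1+j with ℕ.m<1+n⇒m<n∨m≡n i<1+j
  ... | inj₁ i<j  = ℕ.<-trans (enumeration-strictMono i<j) (a-step j)
  ... | inj₂ refl = a-step i

  enumeration-mono : ∀ {i j} → i ≤ j → a i ≤ a j
  enumeration-mono i≤j with ℕ.m≤n⇒m<n∨m≡n i≤j
  ... | inj₁ i<j  = ℕ.<⇒≤ (enumeration-strictMono i<j)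
  ... | inj₂ refl = ℕ.≤-refl

  enumeration-reflects-< : ∀ {i j} → a i < a j → i < j
  enumeration-reflects-< aᵢ<aⱼ = ℕ.≰⇒> (ℕ.<⇒≱ aᵢ<aⱼ ∘ enumeration-mono)

  enumeration-consecutive : ∀ {x y} → InA x → InA y → x < y → (∀ z → x < z → z < y → ¬ InA z) →
                            ∃ λ n → a n ≡ x × a (suc n) ≡ y
  enumeration-consecutive {x} {y} x∈A y∈A x<y nothing-between
    with a-onto x x∈A | a-onto y y∈A
  ... | n , refl | k , refl = n , refl , aₙ₊₁≡aₖ
    where
    aₙ₊₁≡aₖ : a (suc n) ≡ a k
    aₙ₊₁≡aₖ with ℕ.m≤n⇒m<n∨m≡n (enumeration-mono (enumeration-reflects-< x<y))
    ... | inj₁ aₙ₊₁<aₖ = ⊥-elim (nothing-between (a (suc n)) (a-step n) aₙ₊₁<aₖ (a∈A (suc n)))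
    ... | inj₂ aₙ₊₁≡aₖ = aₙ₊₁≡aₖ

witnessPolys : List Poly
witnessPolys = squarePlusOne 130 66 ∷ squarePlusOne 130 74 ∷ []

witnessPolys-irreducible : All IrreducibleP witnessPolys
witnessPolys-irreducible =
  squarePlusOne-irreducible 130 66 (from-yes (coprime? (66 * 66 + 1) 130)) ∷
  squarePlusOne-irreducible 130 74 (from-yes (coprime? (74 * 74 + 1) 130)) ∷ []

witnessPolys-posLeading : All PosLeadingP witnessPolys
witnessPolys-posLeading = squarePlusOne-posLeading 130 66 ∷ squarePlusOne-posLeading 130 74 ∷ []

witnessPolys-bunyakovsky : Bunyakovsky witnessPolys
witnessPolys-bunyakovsky = coprime-values⇒bunyakovsky witnessPolys
  (from-yes (coprime? ∣ evalProduct witnessPolys (+ 0) ∣ ∣ evalProduct witnessPolys (+ 1) ∣))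

gap-residues : ∀ t i → i < 7 → ¬ Prime ((130 * t + (67 + i)) * (130 * t + (67 + i)) + 1)
gap-residues t 0 _ = shifted-square-not-prime 2  67 t (divides 65 refl) (divides 2245 refl) (ℕ.<ᵇ⇒< _ _ tt)
gap-residues t 1 _ = shifted-square-not-prime 5  68 t (divides 26 refl) (divides 925  refl) (ℕ.<ᵇ⇒< _ _ tt)
gap-residues t 2 _ = shifted-square-not-prime 2  69 t (divides 65 refl) (divides 2381 refl) (ℕ.<ᵇ⇒< _ _ tt)
gap-residues t 3 _ = shifted-square-not-prime 13 70 t (divides 10 refl) (divides 377  refl) (ℕ.<ᵇ⇒< _ _ tt)
gap-residues t 4 _ = shifted-square-not-prime 2  71 t (divides 65 refl) (divides 2521 refl) (ℕ.<ᵇ⇒< _ _ tt)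
gap-residues t 5 _ = shifted-square-not-prime 5  72 t (divides 26 refl) (divides 1037 refl) (ℕ.<ᵇ⇒< _ _ tt)
gap-residues t 6 _ = shifted-square-not-prime 2  73 t (divides 65 refl) (divides 2665 refl) (ℕ.<ᵇ⇒< _ _ tt)
gap-residues t (suc (suc (suc (suc (suc (suc (suc i))))))) (s≤s (s≤s (s≤s (s≤s (s≤s (s≤s (s≤s ())))))))

between-∉A : ∀ t z → 130 * t + 66 < z → z < 130 * t + 74 → ¬ InA z
between-∉A t z x<z z<y (_ , z²+1-prime) =
  gap-residues t i i<7 (subst (λ w → Prime (w * w + 1)) z≡x+1+i z²+1-prime)
  where
  x+1≤z : 130 * t + 67 ≤ z
  x+1≤z = subst (_≤ z) (sym (ℕ.+-suc (130 * t) 66)) x<z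
  i : ℕ
  i = z ∸ (130 * t + 67)
  z≡x+1+i : z ≡ 130 * t + (67 + i)
  z≡x+1+i = trans (sym (ℕ.m+[n∸m]≡n x+1≤z)) (ℕ.+-assoc (130 * t) 67 i)
  i<7 : i < 7
  i<7 = ℕ.+-cancelˡ-< (130 * t + 67) i 7
          (subst₂ _<_ (sym (ℕ.m+[n∸m]≡n x+1≤z)) (sym (ℕ.+-assoc (130 * t) 67 7)) z<y)

8∉A : ¬ InA 8
8∉A (_ , 65-prime) = from-no (prime? 65) 65-prime

witnessPolys-prime⇒InA : ∀ t → All (λ f → ∃ λ q → Prime q × eval f (+ t) ≡ + q) witnessPolys →
                         InA (130 * t + 66) × InA (130 * t + 74)
witnessPolys-prime⇒InA t ((_ , q-prime , f[t]≡q) ∷ (_ , q′-prime , f′[t]≡q′) ∷ []) =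
  prime-value⇒InA 130 66 t z<s q-prime f[t]≡q , prime-value⇒InA 130 74 t z<s q′-prime f′[t]≡q′

proposition1 : HypothesisH → (a : ℕ → ℕ) → EnumeratesA a →
    ∀ (N : ℕ) → ∃ λ (n : ℕ) → N ≤ n × ¬ InA (a (suc n) ∸ a n)
proposition1 H a enum N =
  let t , aN<t , values-prime =
        H witnessPolys witnessPolys-irreducible witnessPolys-posLeading witnessPolys-bunyakovsky (a N)
      x∈A , y∈A = witnessPolys-prime⇒InA t values-prime
      n , aₙ≡x , aₙ₊₁≡y =
        enumeration-consecutive enum x∈A y∈A (ℕ.+-monoʳ-< (130 * t) (ℕ.<ᵇ⇒< 66 74 tt)) (between-∉A t)
      N<n = enumeration-reflects-< enum (subst (a N <_) (sym aₙ≡x)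
              (ℕ.<-≤-trans aN<t (ℕ.≤-trans (ℕ.m≤n*m t 130) (ℕ.m≤m+n (130 * t) 66))))
      gap≡8 = trans (cong₂ _∸_ aₙ₊₁≡y aₙ≡x) (ℕ.[m+n]∸[m+o]≡n∸o (130 * t) 74 66)
  in  n , ℕ.<⇒≤ N<n , 8∉A ∘ subst InA gap≡8
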